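{- In the setting described in the context, $|\mathbf{T}|=\gamma_0(\mathbf{T},\mathrm{X})+\mathrm{val}(\mathrm{X})\,\gamma_1(\mathbf{T},\mathrm{X})$ and $\mathcal{L}_{\mathbf{T},\mathrm{X}}=\gamma_1(\mathbf{T},\mathrm{X})\,\mathcal{L}_{\mathrm{X}}$.
   Context: Let $\mathrm{X}$ be a finite distance-regular graph with graph distance $\partial$ and let a finite group $\mathrm{G}$ act on $\mathrm{X}$ so that $\mathrm{X}$ is two-point homogeneous: whenever $\partial(x_1,x_2)=\partial(y_1,y_2)$ there is $g\in\mathrm{G}$ with $gx_1=y_1$, $gx_2=y_2$. Let $\mathbf{S}_1(x)=\{y\in\mathrm{X}:\partial(x,y)=1\}$ and $\mathrm{val}(\mathrm{X})=|\mathbf{S}_1(x)|$ (independent of $x$). Let $\mathrm{V}$ be the space of functions $\mathrm{X}\to\mathbb{C}$ and $\mathcal{L}_{\mathrm{X}}\varphi(x)=\sum_{y\in\mathbf{S}_1(x)}(\varphi(y)-\varphi(x))$. Let $\mathbf{T}\subset\mathrm{G}$ satisfy $\mathbf{T}=\mathbf{T}^{ -1}$, $g\mathbf{T}g^{ -1}=\mathbf{T}$ for all $g\in\mathrm{G}$, $\partial(x,hx)\le1$ for all $x\in\mathrm{X}$, $h\in\mathbf{T}$, and $\mathbf{T}\not\subseteq\mathrm{G}_x$ (the stabilizer of $x$) for some $x$. Define $\mathcal{L}_{\mathbf{T},\mathrm{X}}\varphi(x)=\sum_{h\in\mathbf{T}}(\varphi(hx)-\varphi(x))$, $\gamma_0(\mathbf{T},\mathrm{X})=|\{h\in\mathbf{T}:hx=x\}|$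 and $\gamma_1(\mathbf{T},\mathrm{X})=|\{h\in\mathbf{T}:hx=y\}|$ for $x\in\mathrm{X}$, $y\in\mathbf{S}_1(x)$; these numbers do not depend on the choice of $x,y$. -}

module Defs where

open import Level using (Level)
open import Data.Nat using (ℕ; zero; suc; _≤_)
open import Data.Nat.Properties using () renaming (_≟_ to _≟ℕ_)
open import Data.Fin using (Fin; _≟_)
open import Data.Fin.Subset using (Subset; _∈_; _∉_)
open import Data.Fin.Subset.Properties using (_∈?_)
open import Data.List using (List; []; _∷_; length; filter; map; foldr; allFin)
open import Data.Product using (Σ; _×_; _,_; ∃; ∃-syntax)
open import Relation.Nullary using (¬_; Dec)
open import Relation.Unary using (Pred; Decidable)
open import Relation.Binary.PropositionalEquality using (_≡_; _≢_)
open import Relation.Nullary.Decidable using (_×-dec_)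
open import Algebra.Structures using (IsGroup)
open import Algebra.Bundles using (CommutativeRing)

count : ∀ {n} {P : Pred (Fin n) Level.zero} → Decidable P → ℕ
count {n} P? = length (filter P? (allFin n))

record IsSimpleGraph {n : ℕ} (E : Fin n → Fin n → Set) : Set where
  field
    sym   : ∀ x y → E x y → E y x
    irrefl : ∀ x → ¬ E x x

data Walk {n : ℕ} (E : Fin n → Fin n → Set) : Fin n → Fin n → ℕ → Set where
  here : ∀ x → Walk E x x zero
  step : ∀ {x y z k} → E x y → Walk E y z k → Walk E x z (suc k)

-- ∂ is the graph distance of E: ∂ x y is the length of a shortest walk
-- (in particular the graph is connected)
record IsGraphDistance {n : ℕ} (E : Fin n → Fin n → Set)
                       (∂ : Fin n → Fin n → ℕ) : Set where
  field
    realised : ∀ x y → Walk E x y (∂ x y)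
    minimal  : ∀ x y k → Walk E x y k → ∂ x y ≤ k

IsDistanceRegular : ∀ {n} → (Fin n → Fin n → ℕ) → Set
IsDistanceRegular {n} ∂ =
  ∀ x y x′ y′ → ∂ x y ≡ ∂ x′ y′ → ∀ j k →
    count (λ z → (∂ x z ≟ℕ j) ×-dec (∂ y z ≟ℕ k))
      ≡ count (λ z → (∂ x′ z ≟ℕ j) ×-dec (∂ y′ z ≟ℕ k))

record IsGraphAction {n m : ℕ} (E : Fin n → Fin n → Set)
       (_·_ : Fin m → Fin m → Fin m) (e : Fin m)
       (act : Fin m → Fin n → Fin n) : Set where
  field
    act-id   : ∀ x → act e x ≡ x
    act-comp : ∀ g h x → act (g · h) x ≡ act g (act h x)
    act-adj  : ∀ g x y → E x y → E (act g x) (act g y)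

IsTwoPointHomogeneous : ∀ {n m} → (Fin n → Fin n → ℕ) →
                        (Fin m → Fin n → Fin n) → Set
IsTwoPointHomogeneous {n} {m} ∂ act =
  ∀ x₁ x₂ y₁ y₂ → ∂ x₁ x₂ ≡ ∂ y₁ y₂ →
    ∃[ g ] (act g x₁ ≡ y₁ × act g x₂ ≡ y₂)

record IsAdmissibleT {n m : ℕ} (∂ : Fin n → Fin n → ℕ)
       (_·_ : Fin m → Fin m → Fin m) (_⁻¹ : Fin m → Fin m)
       (act : Fin m → Fin n → Fin n) (T : Subset m) : Set where
  field
    inv-⊆ : ∀ h → h ∈ T → (h ⁻¹) ∈ T
    inv-⊇ : ∀ k → k ∈ T → ∃[ h ] (h ∈ T × k ≡ h ⁻¹)
    conj-⊆ : ∀ g h → h ∈ T → ((g · h) · (g ⁻¹)) ∈ T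
    conj-⊇ : ∀ g k → k ∈ T → ∃[ h ] (h ∈ T × k ≡ (g · h) · (g ⁻¹))
    moves-≤1 : ∀ x h → h ∈ T → ∂ x (act h x) ≤ 1
    not-in-stab : ∃[ x ] ∃[ h ] (h ∈ T × act h x ≢ x)

val : ∀ {n} → (Fin n → Fin n → ℕ) → Fin n → ℕ
val ∂ x = count (λ y → ∂ x y ≟ℕ 1)

module _ {n m : ℕ} (act : Fin m → Fin n → Fin n) where
  γ₀ : Subset m → Fin n → ℕ
  γ₀ T x = count (λ h → (h ∈? T) ×-dec (act h x ≟ x))

  γ₁ : Subset m → Fin n → Fin n → ℕ
  γ₁ T x y = count (λ h → (h ∈? T) ×-dec (act h x ≟ y))

module Laplacians {c ℓ} (R : CommutativeRing c ℓ) where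
  open CommutativeRing R

  ΣR : List Carrier → Carrier
  ΣR = foldr _+_ 0#

  _·ℕ_ : ℕ → Carrier → Carrier
  zero  ·ℕ r = 0#
  suc k ·ℕ r = r + (k ·ℕ r)

  𝓛X : ∀ {n} → (Fin n → Fin n → ℕ) → (Fin n → Carrier) → Fin n → Carrier
  𝓛X {n} ∂ φ x =
    ΣR (map (λ y → φ y - φ x) (filter (λ y → ∂ x y ≟ℕ 1) (allFin n)))

  𝓛TX : ∀ {n m} → (Fin m → Fin n → Fin n) → Subset m →
        (Fin n → Carrier) → Fin n → Carrier
  𝓛TX {n} {m} act T φ x =
    ΣR (map (λ h → φ (act h x) - φ x) (filter (_∈? T) (allFin m)))

{-# OPTIONS --safe #-}

-- Split the sum over h ∈ T according to the point h z.  Since ∂ (z , h z) ≤ 1, only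
-- y = z and the neighbours y of z occur, with multiplicities γ₁ (z , z) = γ₀ (z) and
-- γ₁ (z , y).  If g carries the edge (x , y) to the edge (z , y′), conjugation by g
-- permutes T and maps {h : h x = y} onto {h : h z = y′}, so γ₁ is the same on all
-- edges.  Hence Σ_{h ∈ T} w (h z) = γ₀ w (z) + γ₁ Σ_{y ∈ S₁(z)} w (y) for every weight
-- w with values in a commutative monoid: w = 1 counts T, and w = φ - φ (z), which
-- vanishes at z, gives the Laplacian identity.

module Submission where

open import Defs
open import Level using (0ℓ)
open import Algebra.Bundles using (CommutativeRing; CommutativeMonoid; Group)
open import Algebra.Structures using (IsGroup)
open import Data.Bool using (true; false; if_then_else_)
open import Data.Fin using (Fin; zero; suc; _≟_)
open import Data.Fin.Permutation using (Permutation; permutation; _⟨$⟩ʳ_)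
open import Data.Fin.Subset using (Subset; ∣_∣; inside; outside; _∈_)
open import Data.Fin.Subset.Properties using (_∈?_)
open import Data.List using (List; []; _∷_; length; filter; map; foldr; allFin; tabulate)
open import Data.List.Properties using (map-tabulate; filter-≐; filter-none)
open import Data.List.Relation.Unary.All using (universal)
open import Data.Nat using (ℕ; zero; suc; _+_; _*_)
open import Data.Nat.Properties
  using (+-0-commutativeMonoid; *-identityʳ; *-comm; ≤∧≢⇒<; n<1⇒n≡0; n≤0⇒n≡0)
  renaming (_≟_ to _≟ℕ_)
open import Data.Product using (_×_; _,_)
open import Data.Vec using ([]; _∷_)
open import Function using (_∘_; id)
open import Relation.Nullary using (Dec; yes; no; does; ¬_; contradiction)
open import Relation.Nullary.Decidable using (_×-dec_)
open import Relation.Unary using (Pred; Decidable; _≐_)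
open import Relation.Binary.PropositionalEquality using (_≡_)
import Relation.Binary.PropositionalEquality as ≡

module IndicatorSums {a ℓ} (M : CommutativeMonoid a ℓ) where
  open CommutativeMonoid M
  open import Algebra.Properties.CommutativeMonoid.Sum M public
  open import Algebra.Properties.Monoid.Mult monoid public
    using (×-congʳ) renaming (_×_ to _×ₘ_)
  open import Relation.Binary.Reasoning.Setoid setoid

  [_]·_ : ∀ {p} {A : Set p} → Dec A → Carrier → Carrier
  [ d ]· r = if does d then r else ε

  foldr-map-filter : ∀ {b p} {B : Set b} {P : Pred B p} (P? : Decidable P)
    (f : B → Carrier) (xs : List B) →
    foldr _∙_ ε (map f (filter P? xs)) ≈ foldr _∙_ ε (map (λ u → [ P? u ]· f u) xs)
  foldr-map-filter P? f [] = refl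
  foldr-map-filter P? f (u ∷ us) with does (P? u)
  ... | true  = ∙-congˡ (foldr-map-filter P? f us)
  ... | false = trans (foldr-map-filter P? f us) (sym (identityˡ _))

  foldr-tabulate : ∀ {n} (f : Fin n → Carrier) → foldr _∙_ ε (tabulate f) ≡ sum f
  foldr-tabulate {zero}  f = ≡.refl
  foldr-tabulate {suc n} f = ≡.cong (f zero ∙_) (foldr-tabulate (f ∘ suc))

  foldr-map-const : ∀ {b} {B : Set b} (r : Carrier) (xs : List B) →
    foldr _∙_ ε (map (λ _ → r) xs) ≡ length xs ×ₘ r
  foldr-map-const r []       = ≡.refl
  foldr-map-const r (_ ∷ xs) = ≡.cong (r ∙_) (foldr-map-const r xs)

  sum-filter : ∀ {n p} {P : Pred (Fin n) p} (P? : Decidable P) (f : Fin n → Carrier) →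
    foldr _∙_ ε (map f (filter P? (allFin n))) ≈ ∑[ i < n ] [ P? i ]· f i
  sum-filter {n} P? f = begin
    foldr _∙_ ε (map f (filter P? (allFin n)))
      ≈⟨ foldr-map-filter P? f (allFin n) ⟩
    foldr _∙_ ε (map (λ i → [ P? i ]· f i) (allFin n))
      ≡⟨ ≡.cong (foldr _∙_ ε) (map-tabulate id (λ i → [ P? i ]· f i)) ⟩
    foldr _∙_ ε (tabulate (λ i → [ P? i ]· f i))
      ≡⟨ foldr-tabulate (λ i → [ P? i ]· f i) ⟩
    ∑[ i < n ] [ P? i ]· f i
      ∎

  sum-indicator-const : ∀ {n} {P : Pred (Fin n) 0ℓ} (P? : Decidable P) (r : Carrier) →
    ∑[ i < n ] [ P? i ]· r ≈ count P? ×ₘ r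
  sum-indicator-const {n} P? r =
    trans (sym (sum-filter P? (λ _ → r))) (reflexive (foldr-map-const r (filter P? (allFin n))))

  sum-indicator-≟ : ∀ {n} (a : Fin n) (w : Fin n → Carrier) → ∑[ y < n ] [ a ≟ y ]· w y ≈ w a
  sum-indicator-≟ {suc n} zero    w = trans (∙-congˡ (sum-replicate-zero n)) (identityʳ _)
  sum-indicator-≟ {suc n} (suc a) w = trans (identityˡ _) (sum-indicator-≟ a (w ∘ suc))

  indicator-as-sum : ∀ {p} {A : Set p} {n} (d : Dec A) (a : Fin n) (w : Fin n → Carrier) →
    [ d ]· w a ≈ ∑[ y < n ] [ d ×-dec (a ≟ y) ]· w y
  indicator-as-sum         (yes _) a w = sym (sum-indicator-≟ a w)
  indicator-as-sum {n = n} (no _)  a w = sym (sum-replicate-zero n)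

  sum-fibres : ∀ {m n} {P : Pred (Fin m) 0ℓ} (P? : Decidable P)
    (f : Fin m → Fin n) (w : Fin n → Carrier) →
    ∑[ h < m ] [ P? h ]· w (f h) ≈ ∑[ y < n ] (count (λ h → P? h ×-dec (f h ≟ y)) ×ₘ w y)
  sum-fibres {m} {n} P? f w = begin
    ∑[ h < m ] [ P? h ]· w (f h)
      ≈⟨ sum-cong-≋ (λ h → indicator-as-sum (P? h) (f h) w) ⟩
    ∑[ h < m ] ∑[ y < n ] [ P? h ×-dec (f h ≟ y) ]· w y
      ≈⟨ ∑-comm (λ h y → [ P? h ×-dec (f h ≟ y) ]· w y) ⟩
    ∑[ y < n ] ∑[ h < m ] [ P? h ×-dec (f h ≟ y) ]· w y
      ≈⟨ sum-cong-≋ (λ y → sum-indicator-const (λ h → P? h ×-dec (f h ≟ y)) (w y)) ⟩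
    ∑[ y < n ] (count (λ h → P? h ×-dec (f h ≟ y)) ×ₘ w y)
      ∎

  ×ₘ-ε : ∀ k → k ×ₘ ε ≈ ε
  ×ₘ-ε k = trans (sym (sum-replicate k)) (sum-replicate-zero k)

  sum-×ₘ : ∀ {n} k (f : Fin n → Carrier) → ∑[ i < n ] (k ×ₘ f i) ≈ k ×ₘ sum f
  sum-×ₘ {n} zero    f = sum-replicate-zero n
  sum-×ₘ     (suc k) f = trans (∑-distrib-+ f (λ i → k ×ₘ f i)) (∙-congˡ (sum-×ₘ k f))

open ≡ using (_≢_; refl; sym; trans; cong; cong₂; subst; module ≡-Reasoning)

module ℕΣ = IndicatorSums +-0-commutativeMonoid

×ₘ≡* : ∀ k r → k ℕΣ.×ₘ r ≡ k * r
×ₘ≡* zero    r = refl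
×ₘ≡* (suc k) r = cong (r +_) (×ₘ≡* k r)

·ℕ≡×ₘ : ∀ {c ℓ} (R : CommutativeRing c ℓ) k r →
  Laplacians._·ℕ_ R k r ≡ IndicatorSums._×ₘ_ (CommutativeRing.+-commutativeMonoid R) k r
·ℕ≡×ₘ R zero    r = refl
·ℕ≡×ₘ R (suc k) r = cong (CommutativeRing._+_ R r) (·ℕ≡×ₘ R k r)

count≡sum : ∀ {n} {P : Pred (Fin n) 0ℓ} (P? : Decidable P) →
  count P? ≡ ℕΣ.sum (λ i → ℕΣ.[ P? i ]· 1)
count≡sum P? = sym (begin
  ℕΣ.sum (λ i → ℕΣ.[ P? i ]· 1)  ≡⟨ ℕΣ.sum-indicator-const P? 1 ⟩
  count P? ℕΣ.×ₘ 1               ≡⟨ ×ₘ≡* (count P?) 1 ⟩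
  count P? * 1                   ≡⟨ *-identityʳ (count P?) ⟩
  count P?                       ∎)
  where open ≡-Reasoning

∣p∣≡sum : ∀ {n} (p : Subset n) → ∣ p ∣ ≡ ℕΣ.sum (λ i → ℕΣ.[ i ∈? p ]· 1)
∣p∣≡sum []            = refl
∣p∣≡sum (inside  ∷ p) = cong suc (∣p∣≡sum p)
∣p∣≡sum (outside ∷ p) = ∣p∣≡sum p

count-permute : ∀ {n} {P : Pred (Fin n) 0ℓ} (P? : Decidable P) (π : Permutation n n) →
  count P? ≡ count (P? ∘ (π ⟨$⟩ʳ_))
count-permute P? π = begin
  count P?                                        ≡⟨ count≡sum P? ⟩
  ℕΣ.sum (λ i → ℕΣ.[ P? i ]· 1)                  ≡⟨ ℕΣ.sum-permute (λ i → ℕΣ.[ P? i ]· 1) π ⟩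
  ℕΣ.sum (λ i → ℕΣ.[ P? (π ⟨$⟩ʳ i) ]· 1)         ≡⟨ sym (count≡sum (P? ∘ (π ⟨$⟩ʳ_))) ⟩
  count (P? ∘ (π ⟨$⟩ʳ_))                          ∎
  where open ≡-Reasoning

count-cong : ∀ {n} {P Q : Pred (Fin n) 0ℓ} (P? : Decidable P) (Q? : Decidable Q) →
  P ≐ Q → count P? ≡ count Q?
count-cong {n} P? Q? P≐Q = cong length (filter-≐ P? Q? P≐Q (allFin n))

count-none : ∀ {n} {P : Pred (Fin n) 0ℓ} (P? : Decidable P) → (∀ i → ¬ P i) → count P? ≡ 0
count-none {n} P? ¬P = cong length (filter-none P? (universal ¬P (allFin n)))

walk₀⇒≡ : ∀ {n} {E : Fin n → Fin n → Set} {u v} → Walk E u v 0 → u ≡ v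
walk₀⇒≡ (here _) = refl

module GraphDistance {n} {E : Fin n → Fin n → Set} {∂ : Fin n → Fin n → ℕ}
                     (gd : IsGraphDistance E ∂) where
  open IsGraphDistance gd

  ∂≡0⇒≡ : ∀ {u v} → ∂ u v ≡ 0 → u ≡ v
  ∂≡0⇒≡ {u} {v} d = walk₀⇒≡ (subst (Walk E u v) d (realised u v))

  ∂-refl : ∀ u → ∂ u u ≡ 0
  ∂-refl u = n≤0⇒n≡0 (minimal u u 0 (here u))

module GroupAction {n m} {E : Fin n → Fin n → Set}
    {_·_ : Fin m → Fin m → Fin m} {e : Fin m} {_⁻¹ : Fin m → Fin m}
    {act : Fin m → Fin n → Fin n}
    (isG : IsGroup _≡_ _·_ e _⁻¹) (ga : IsGraphAction E _·_ e act) where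
  open IsGroup isG using (assoc; identityˡ; identityʳ; inverseˡ; inverseʳ)
  open IsGraphAction ga using (act-id; act-comp)

  group : Group _ _
  group = record { isGroup = isG }

  open import Algebra.Properties.Group group using (⁻¹-anti-homo-∙; ε⁻¹≈ε)
  open ≡-Reasoning

  act-inverseˡ : ∀ g u → act (g ⁻¹) (act g u) ≡ u
  act-inverseˡ g u = begin
    act (g ⁻¹) (act g u)  ≡⟨ act-comp (g ⁻¹) g u ⟨
    act ((g ⁻¹) · g) u    ≡⟨ cong (λ k → act k u) (inverseˡ g) ⟩
    act e u               ≡⟨ act-id u ⟩
    u                     ∎

  act-injective : ∀ g {u v} → act g u ≡ act g v → u ≡ v
  act-injective g {u} {v} eq = begin
    u                     ≡⟨ act-inverseˡ g u ⟨
    act (g ⁻¹) (act g u)  ≡⟨ cong (act (g ⁻¹)) eq ⟩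
    act (g ⁻¹) (act g v)  ≡⟨ act-inverseˡ g v ⟩
    v                     ∎

  conj : Fin m → Fin m → Fin m
  conj g h = (g · h) · (g ⁻¹)

  conj-homo : ∀ g g′ h → conj g (conj g′ h) ≡ conj (g · g′) h
  conj-homo g g′ h = begin
    (g · ((g′ · h) · (g′ ⁻¹))) · (g ⁻¹)  ≡⟨ cong (_· (g ⁻¹)) (assoc g (g′ · h) (g′ ⁻¹)) ⟨
    ((g · (g′ · h)) · (g′ ⁻¹)) · (g ⁻¹)  ≡⟨ assoc (g · (g′ · h)) (g′ ⁻¹) (g ⁻¹) ⟩
    (g · (g′ · h)) · ((g′ ⁻¹) · (g ⁻¹))  ≡⟨ cong₂ _·_ (sym (assoc g g′ h)) (sym (⁻¹-anti-homo-∙ g g′)) ⟩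
    ((g · g′) · h) · ((g · g′) ⁻¹)        ∎

  conj-identity : ∀ h → conj e h ≡ h
  conj-identity h = trans (cong₂ _·_ (identityˡ h) ε⁻¹≈ε) (identityʳ h)

  conj-inverseˡ : ∀ g h → conj (g ⁻¹) (conj g h) ≡ h
  conj-inverseˡ g h =
    trans (conj-homo (g ⁻¹) g h) (trans (cong (λ k → conj k h) (inverseˡ g)) (conj-identity h))

  conj-inverseʳ : ∀ g h → conj g (conj (g ⁻¹) h) ≡ h
  conj-inverseʳ g h =
    trans (conj-homo g (g ⁻¹) h) (trans (cong (λ k → conj k h) (inverseʳ g)) (conj-identity h))

  conj-permutation : Fin m → Permutation m m
  conj-permutation g = permutation (conj g) (conj (g ⁻¹)) (conj-inverseʳ g) (conj-inverseˡ g)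

  act-conj : ∀ g h u → act (conj g h) (act g u) ≡ act g (act h u)
  act-conj g h u = begin
    act ((g · h) · (g ⁻¹)) (act g u)      ≡⟨ act-comp (g · h) (g ⁻¹) (act g u) ⟩
    act (g · h) (act (g ⁻¹) (act g u))    ≡⟨ cong (act (g · h)) (act-inverseˡ g u) ⟩
    act (g · h) u                         ≡⟨ act-comp g h u ⟩
    act g (act h u)                       ∎

module AdmissibleAction {n m} {E : Fin n → Fin n → Set} {∂ : Fin n → Fin n → ℕ}
    {_·_ : Fin m → Fin m → Fin m} {e : Fin m} {_⁻¹ : Fin m → Fin m}
    {act : Fin m → Fin n → Fin n} {T : Subset m}
    (gd : IsGraphDistance E ∂) (isG : IsGroup _≡_ _·_ e _⁻¹) (ga : IsGraphAction E _·_ e act)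
    (tph : IsTwoPointHomogeneous ∂ act) (adm : IsAdmissibleT ∂ _·_ _⁻¹ act T) where
  open GraphDistance gd
  open GroupAction isG ga
  open IsAdmissibleT adm using (conj-⊆; moves-≤1)

  conj-reflects-∈ : ∀ g h → conj g h ∈ T → h ∈ T
  conj-reflects-∈ g h gh∈T = subst (_∈ T) (conj-inverseˡ g h) (conj-⊆ (g ⁻¹) (conj g h) gh∈T)

  γ₁-act-invariant : ∀ g u v → γ₁ act T (act g u) (act g v) ≡ γ₁ act T u v
  γ₁-act-invariant g u v = begin
    count Q?                              ≡⟨ count-permute Q? (conj-permutation g) ⟩
    count (Q? ∘ conj g)                   ≡⟨ count-cong (Q? ∘ conj g) P? (from , to) ⟩
    count P?                              ∎
    where
      open ≡-Reasoning
      Q? = λ h → (h ∈? T) ×-dec (act h (act g u) ≟ act g v)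
      P? = λ h → (h ∈? T) ×-dec (act h u ≟ v)
      to : ∀ {h} → h ∈ T × act h u ≡ v → conj g h ∈ T × act (conj g h) (act g u) ≡ act g v
      to {h} (h∈T , hu≡v) = conj-⊆ g h h∈T , trans (act-conj g h u) (cong (act g) hu≡v)
      from : ∀ {h} → conj g h ∈ T × act (conj g h) (act g u) ≡ act g v → h ∈ T × act h u ≡ v
      from {h} (gh∈T , eq) = conj-reflects-∈ g h gh∈T , act-injective g (trans (sym (act-conj g h u)) eq)

  γ₁-∂-invariant : ∀ {u v u′ v′} → ∂ u v ≡ ∂ u′ v′ → γ₁ act T u v ≡ γ₁ act T u′ v′
  γ₁-∂-invariant {u} {v} {u′} {v′} d with tph u v u′ v′ d
  ... | g , refl , refl = sym (γ₁-act-invariant g u v)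

  γ₁-far : ∀ {u v} → u ≢ v → ∂ u v ≢ 1 → γ₁ act T u v ≡ 0
  γ₁-far {u} {v} u≢v ∂≢1 = count-none (λ h → (h ∈? T) ×-dec (act h u ≟ v)) moves-elsewhere
    where
      moves-elsewhere : ∀ h → ¬ (h ∈ T × act h u ≡ v)
      moves-elsewhere h (h∈T , refl) =
        u≢v (∂≡0⇒≡ (n<1⇒n≡0 (≤∧≢⇒< (moves-≤1 u h h∈T) ∂≢1)))

  module _ {a ℓ} (M : CommutativeMonoid a ℓ) {x y : Fin n} (x∼y : ∂ x y ≡ 1) where
    open CommutativeMonoid M
      using (Carrier; _≈_; _∙_; ε; setoid; ∙-cong; ∙-congˡ; ∙-congʳ; identityˡ; identityʳ)
    open IndicatorSums M
    open import Relation.Binary.Reasoning.Setoid setoid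

    -- The decisions are arguments: in the goal `does (∂ z y′ ≟ℕ 1)` has already
    -- evaluated to `∂ z y′ ≡ᵇ 1`, so `with ∂ z y′ ≟ℕ 1` would not abstract it.
    γ₁-weighted : ∀ z y′ (z≟y′ : Dec (z ≡ y′)) (z∼?y′ : Dec (∂ z y′ ≡ 1)) (w : Fin n → Carrier) →
      γ₁ act T z y′ ×ₘ w y′ ≈ γ₀ act T z ×ₘ [ z≟y′ ]· w y′ ∙ γ₁ act T x y ×ₘ [ z∼?y′ ]· w y′
    γ₁-weighted z _ (yes refl) (yes z∼z)  w = contradiction (trans (sym (∂-refl z)) z∼z) (λ ())
    γ₁-weighted z _ (yes refl) (no _)     w = begin
      γ₀ act T z ×ₘ w z                    ≈⟨ identityʳ _ ⟨
      γ₀ act T z ×ₘ w z ∙ ε                ≈⟨ ∙-congˡ (×ₘ-ε (γ₁ act T x y)) ⟨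
      γ₀ act T z ×ₘ w z ∙ γ₁ act T x y ×ₘ ε ∎
    γ₁-weighted z y′ (no _)    (yes z∼y′) w = begin
      γ₁ act T z y′ ×ₘ w y′                ≡⟨ cong (_×ₘ w y′) (γ₁-∂-invariant (trans z∼y′ (sym x∼y))) ⟩
      γ₁ act T x y ×ₘ w y′                 ≈⟨ identityˡ _ ⟨
      ε ∙ γ₁ act T x y ×ₘ w y′             ≈⟨ ∙-congʳ (×ₘ-ε (γ₀ act T z)) ⟨
      γ₀ act T z ×ₘ ε ∙ γ₁ act T x y ×ₘ w y′ ∎
    γ₁-weighted z y′ (no z≢y′) (no ∂≢1)   w = begin
      γ₁ act T z y′ ×ₘ w y′                ≡⟨ cong (_×ₘ w y′) (γ₁-far z≢y′ ∂≢1) ⟩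
      ε                                    ≈⟨ identityˡ ε ⟨
      ε ∙ ε                                ≈⟨ ∙-cong (×ₘ-ε (γ₀ act T z)) (×ₘ-ε (γ₁ act T x y)) ⟨
      γ₀ act T z ×ₘ ε ∙ γ₁ act T x y ×ₘ ε  ∎

    ∑T≈γ₀+γ₁∑S₁ : ∀ z (w : Fin n → Carrier) →
      ∑[ h < m ] [ h ∈? T ]· w (act h z)
        ≈ γ₀ act T z ×ₘ w z ∙ γ₁ act T x y ×ₘ (∑[ y′ < n ] [ ∂ z y′ ≟ℕ 1 ]· w y′)
    ∑T≈γ₀+γ₁∑S₁ z w = begin
      ∑[ h < m ] [ h ∈? T ]· w (act h z)
        ≈⟨ sum-fibres (_∈? T) (λ h → act h z) w ⟩
      ∑[ y′ < n ] (γ₁ act T z y′ ×ₘ w y′)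
        ≈⟨ sum-cong-≋ (λ y′ → γ₁-weighted z y′ (z ≟ y′) (∂ z y′ ≟ℕ 1) w) ⟩
      ∑[ y′ < n ] (γ₀z ×ₘ [ z ≟ y′ ]· w y′ ∙ γ ×ₘ [ ∂ z y′ ≟ℕ 1 ]· w y′)
        ≈⟨ ∑-distrib-+ (λ y′ → γ₀z ×ₘ [ z ≟ y′ ]· w y′) (λ y′ → γ ×ₘ [ ∂ z y′ ≟ℕ 1 ]· w y′) ⟩
      ∑[ y′ < n ] (γ₀z ×ₘ [ z ≟ y′ ]· w y′) ∙ ∑[ y′ < n ] (γ ×ₘ [ ∂ z y′ ≟ℕ 1 ]· w y′)
        ≈⟨ ∙-cong (sum-×ₘ γ₀z (λ y′ → [ z ≟ y′ ]· w y′))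
                  (sum-×ₘ γ (λ y′ → [ ∂ z y′ ≟ℕ 1 ]· w y′)) ⟩
      γ₀z ×ₘ (∑[ y′ < n ] [ z ≟ y′ ]· w y′) ∙ γ ×ₘ (∑[ y′ < n ] [ ∂ z y′ ≟ℕ 1 ]· w y′)
        ≈⟨ ∙-congʳ (×-congʳ γ₀z (sum-indicator-≟ z w)) ⟩
      γ₀z ×ₘ w z ∙ γ ×ₘ (∑[ y′ < n ] [ ∂ z y′ ≟ℕ 1 ]· w y′)
        ∎
      where
        γ₀z = γ₀ act T z
        γ   = γ₁ act T x y

  ∣T∣≡γ₀+val*γ₁ : ∀ {x y} → ∂ x y ≡ 1 → ∣ T ∣ ≡ γ₀ act T x + val ∂ x * γ₁ act T x y
  ∣T∣≡γ₀+val*γ₁ {x} {y} x∼y = begin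
    ∣ T ∣
      ≡⟨ ∣p∣≡sum T ⟩
    ℕΣ.sum (λ h → ℕΣ.[ h ∈? T ]· 1)
      ≡⟨ ∑T≈γ₀+γ₁∑S₁ +-0-commutativeMonoid x∼y x (λ _ → 1) ⟩
    γ₀ act T x ℕΣ.×ₘ 1 + γ ℕΣ.×ₘ ℕΣ.sum (λ y′ → ℕΣ.[ ∂ x y′ ≟ℕ 1 ]· 1)
      ≡⟨ cong₂ _+_ (×ₘ≡* (γ₀ act T x) 1) (×ₘ≡* γ _) ⟩
    γ₀ act T x * 1 + γ * ℕΣ.sum (λ y′ → ℕΣ.[ ∂ x y′ ≟ℕ 1 ]· 1)
      ≡⟨ cong₂ _+_ (*-identityʳ (γ₀ act T x)) (cong (γ *_) (sym (count≡sum (λ y′ → ∂ x y′ ≟ℕ 1)))) ⟩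
    γ₀ act T x + γ * val ∂ x
      ≡⟨ cong (γ₀ act T x +_) (*-comm γ (val ∂ x)) ⟩
    γ₀ act T x + val ∂ x * γ
      ∎
    where
      open ≡-Reasoning
      γ = γ₁ act T x y

  𝓛TX≈γ₁·𝓛X : ∀ {c ℓ} (R : CommutativeRing c ℓ) {x y} → ∂ x y ≡ 1 →
    ∀ φ z → CommutativeRing._≈_ R (Laplacians.𝓛TX R act T φ z)
                                  (Laplacians._·ℕ_ R (γ₁ act T x y) (Laplacians.𝓛X R ∂ φ z))
  𝓛TX≈γ₁·𝓛X R {x} {y} x∼y φ z = begin
    𝓛TX act T φ z
      ≈⟨ sum-filter (_∈? T) (λ h → δ (act h z)) ⟩
    ∑[ h < m ] [ h ∈? T ]· δ (act h z)
      ≈⟨ ∑T≈γ₀+γ₁∑S₁ +-commutativeMonoid x∼y z δ ⟩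
    γ₀ act T z ×ₘ δ z +ᴿ γ ×ₘ (∑[ y′ < n ] [ ∂ z y′ ≟ℕ 1 ]· δ y′)
      ≈⟨ +-congʳ (×-congʳ (γ₀ act T z) (-‿inverseʳ (φ z))) ⟩
    γ₀ act T z ×ₘ 0# +ᴿ γ ×ₘ (∑[ y′ < n ] [ ∂ z y′ ≟ℕ 1 ]· δ y′)
      ≈⟨ +-congʳ (×ₘ-ε (γ₀ act T z)) ⟩
    0# +ᴿ γ ×ₘ (∑[ y′ < n ] [ ∂ z y′ ≟ℕ 1 ]· δ y′)
      ≈⟨ +-identityˡ _ ⟩
    γ ×ₘ (∑[ y′ < n ] [ ∂ z y′ ≟ℕ 1 ]· δ y′)
      ≈⟨ ×-congʳ γ (sum-filter (λ y′ → ∂ z y′ ≟ℕ 1) δ) ⟨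
    γ ×ₘ 𝓛X ∂ φ z
      ≡⟨ ·ℕ≡×ₘ R γ (𝓛X ∂ φ z) ⟨
    γ ·ℕ 𝓛X ∂ φ z
      ∎
    where
      open CommutativeRing R using (Carrier; _-_; 0#; +-commutativeMonoid; +-congʳ; +-identityˡ; -‿inverseʳ)
        renaming (_+_ to _+ᴿ_)
      open IndicatorSums +-commutativeMonoid
      open Laplacians R using (𝓛TX; 𝓛X; _·ℕ_)
      open import Relation.Binary.Reasoning.Setoid (CommutativeRing.setoid R)
      γ = γ₁ act T x y
      δ : Fin n → Carrier
      δ y′ = φ y′ - φ z

lemma2p1 : ∀ {c ℓ} (R : CommutativeRing c ℓ) {n m : ℕ}
    (E : Fin n → Fin n → Set) (∂ : Fin n → Fin n → ℕ)
    (_·_ : Fin m → Fin m → Fin m) (e : Fin m) (_⁻¹ : Fin m → Fin m)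
    (act : Fin m → Fin n → Fin n) (T : Subset m) →
    IsSimpleGraph E →
    IsGraphDistance E ∂ →
    IsDistanceRegular ∂ →
    IsGroup _≡_ _·_ e _⁻¹ →
    IsGraphAction E _·_ e act →
    IsTwoPointHomogeneous ∂ act →
    IsAdmissibleT ∂ _·_ _⁻¹ act T →
    ∀ (x y : Fin n) → ∂ x y ≡ 1 →
      (∣ T ∣ ≡ γ₀ act T x + val ∂ x * γ₁ act T x y)
      × (∀ (φ : Fin n → CommutativeRing.Carrier R)
           (z : Fin n) →
           CommutativeRing._≈_ R (Laplacians.𝓛TX R act T φ z)
             (Laplacians._·ℕ_ R (γ₁ act T x y) (Laplacians.𝓛X R ∂ φ z)))
lemma2p1 R E ∂ _·_ e _⁻¹ act T _ gd _ isG ga tph adm x y x∼y =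
  ∣T∣≡γ₀+val*γ₁ x∼y , 𝓛TX≈γ₁·𝓛X R x∼y
  where open AdmissibleAction gd isG ga tph adm
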